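{- Let $\alpha_G>1$ and let $G$ be the weighted grid DAG described in the context. Let $s=(i,j)$ be a vertex of $G$ and $t=(i-1,k)$ with $k>j$. Then the shortest $s$-$t$ path $P$ uses one vertical edge followed by a series of horizontal edges, and $P$ is the only $\alpha_G$-approximate shortest $s$-$t$ path in $G$.
   Context: Let $n$ be a perfect square. $G$ is the $\sqrt{n}\times\sqrt{n}$ grid with vertices $(r,c)$, $0\le r,c\le\sqrt{n}-1$ ($r$ = row, $c$ = column, $(0,0)$ the top-left corner). Horizontal edges are directed to the right, $(r,c)\to(r,c+1)$, and have weight $1$. Vertical edges are directed upward, $(r,c)\to(r-1,c)$, and a vertical edge in column $c$ has weight $(\alpha_G\sqrt{n})^{2c}$. A path from $s$ to $t$ is an $\alpha$-approximate shortest path if its weight is at most $\alpha$ times the $s$-$t$ distance.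
   Formalization: The parameter $\alpha_G$ takes rational values only, so the vertical edge weights and the approximation factor are rational as well. -}

module Defs where

open import Data.Nat as ℕ using (ℕ; zero; suc; _<_)
open import Data.Product using (_×_; _,_)
open import Data.Integer using (+_)
open import Data.Rational as ℚ using (ℚ; 1ℚ; _/_)

-- Grid side length m = √n (so n = m * m).  Vertices are pairs (r , c) of
-- row and column, with 0 ≤ r, c ≤ m - 1; (0 , 0) is the top-left corner.
Vertex : Set
Vertex = ℕ × ℕ

InGrid : ℕ → Vertex → Set
InGrid m (r , c) = (r < m) × (c < m)

data Path (m : ℕ) : Vertex → Vertex → Set where
  []    : ∀ {v} → Path m v v
  right : ∀ {r c v} → suc c < m → Path m (r , suc c) v → Path m (r , c) v
  up    : ∀ {r c v} → Path m (r , c) v → Path m (suc r , c) v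

infixr 8 _^_
_^_ : ℚ → ℕ → ℚ
x ^ zero  = 1ℚ
x ^ suc k = x ℚ.* (x ^ k)

fromℕ : ℕ → ℚ
fromℕ k = (+ k) / 1

-- Weight of a path: horizontal edges weigh 1, a vertical edge in column c
-- weighs (α √n)^(2c) = (α m)^(2c).
weight : (α : ℚ) (m : ℕ) {u v : Vertex} → Path m u v → ℚ
weight α m []                     = ℚ.0ℚ
weight α m (right _ p)            = 1ℚ ℚ.+ weight α m p
weight α m (up {c = c} p)         = ((α ℚ.* fromℕ m) ^ (2 ℕ.* c)) ℚ.+ weight α m p

IsShortest : (α : ℚ) (m : ℕ) {u v : Vertex} → Path m u v → Set
IsShortest α m {u} {v} P = (Q : Path m u v) → weight α m P ℚ.≤ weight α m Q

-- P is an β-approximate shortest u-v path: weight P ≤ β · dist(u,v),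
-- where dist(u,v) is the minimum weight of a u-v path; equivalently
-- weight P ≤ β · weight Q for every u-v path Q.
IsApproxShortest : (β α : ℚ) (m : ℕ) {u v : Vertex} → Path m u v → Set
IsApproxShortest β α m {u} {v} P =
  (Q : Path m u v) → weight α m P ℚ.≤ β ℚ.* weight α m Q

data Horizontal {m : ℕ} : {u v : Vertex} → Path m u v → Set where
  []    : ∀ {v} → Horizontal ([] {v = v})
  right : ∀ {r c v} (h : suc c < m) {p : Path m (r , suc c) v} →
          Horizontal p → Horizontal (right h p)

data UpThenHorizontal {m : ℕ} : {u v : Vertex} → Path m u v → Set where
  up : ∀ {r c v} {p : Path m (r , c) v} → Horizontal p → UpThenHorizontal (up p)

{-# OPTIONS --safe #-}
module Submission where

-- A path from row i + 1 to row i climbs exactly once.  Climbing in column j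
-- and then walking right costs (α m)^(2j) + (k − j) ≤ (α m)^(2j) + m.  A path
-- that first moves right climbs in a column c > j, which alone costs
-- (α m)^(2c) ≥ (α m)^(2j + 2) = α · m · (α m)^(2j + 1); since m ≥ 2 this is at
-- least α times the first cost, and the first horizontal step makes the
-- detour strictly heavier.  Within a row there is only one path, so the first
-- path is the unique α-approximate shortest one.

open import Defs
open import Data.Empty using (⊥-elim)
open import Data.Integer as ℤ using (+_)
import Data.Integer.Properties as ℤ
open import Data.Nat as ℕ using (ℕ; zero; suc; _<_; z≤n; s≤s; _≤‴_; ≤‴-refl; ≤‴-step)
import Data.Nat.Properties as ℕ
open import Data.Nat.Divisibility using (∣1⇒≡1)
open import Data.Product using (Σ; _×_; _,_; proj₂)
open import Data.Rational using (ℚ; 1ℚ)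
open import Data.Rational as ℚ using (0ℚ; mkℚ; toℚᵘ; _+_; _*_; _≤_; nonNegative)
open import Data.Rational.Properties as ℚ
  using ( ≤-refl; ≤-reflexive; ≤-trans; <⇒≤; <-irrefl; <-≤-trans
        ; +-comm; +-assoc; +-identityˡ; *-assoc; *-identityˡ; *-identityʳ
        ; *-zeroʳ; *-distribʳ-+; +-mono-≤; +-monoʳ-≤; +-monoˡ-<
        ; *-monoˡ-≤-nonNeg; *-monoʳ-≤-nonNeg; module ≤-Reasoning)
import Data.Rational.Unnormalised as ℚᵘ
import Data.Rational.Unnormalised.Properties as ℚᵘ
open import Relation.Binary.PropositionalEquality
  using (_≡_; refl; sym; trans; cong; cong₂; subst; subst₂; module ≡-Reasoning)

private
  variable
    m r r′ c k : ℕ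
    p q s : ℚ
    u v : Vertex

fromℕ≡mkℚ : ∀ n → fromℕ n ≡ mkℚ (+ n) 0 (λ g → ∣1⇒≡1 (proj₂ g))
fromℕ≡mkℚ n = ℚ.normalize-coprime _

fromℕ-suc : ∀ n → fromℕ (suc n) ≡ 1ℚ + fromℕ n
fromℕ-suc n = ℚ.toℚᵘ-injective
  (ℚᵘ.≃-trans unnormalised (ℚᵘ.≃-sym (ℚ.toℚᵘ-homo-+ 1ℚ (fromℕ n))))
  where
  unnormalised : toℚᵘ (fromℕ (suc n)) ℚᵘ.≃ toℚᵘ 1ℚ ℚᵘ.+ toℚᵘ (fromℕ n)
  unnormalised rewrite fromℕ≡mkℚ (suc n) | fromℕ≡mkℚ n = ℚᵘ.*≡* (begin
    + suc n ℤ.* + 1                        ≡⟨ ℤ.*-identityʳ (+ suc n) ⟩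
    + 1 ℤ.+ + n                            ≡⟨ cong (ℤ._+_ (+ 1)) (sym (ℤ.*-identityʳ (+ n))) ⟩
    + 1 ℤ.* + 1 ℤ.+ + n ℤ.* + 1            ≡⟨ sym (ℤ.*-identityʳ _) ⟩
    (+ 1 ℤ.* + 1 ℤ.+ + n ℤ.* + 1) ℤ.* + 1  ∎)
    where open ≡-Reasoning

fromℕ-mono-≤ : ∀ {a b} → a ℕ.≤ b → fromℕ a ≤ fromℕ b
fromℕ-mono-≤ {a} {b} a≤b rewrite fromℕ≡mkℚ a | fromℕ≡mkℚ b =
  ℚ.*≤* (subst₂ ℤ._≤_ (sym (ℤ.*-identityʳ (+ a))) (sym (ℤ.*-identityʳ (+ b))) (ℤ.+≤+ a≤b))

0≤1 : 0ℚ ≤ 1ℚ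
0≤1 = ℚ.*≤* (ℤ.+≤+ z≤n)

1≤p⇒0≤p : 1ℚ ≤ p → 0ℚ ≤ p
1≤p⇒0≤p = ≤-trans 0≤1

*-monoˡ-≤-0≤ : 0ℚ ≤ s → p ≤ q → s * p ≤ s * q
*-monoˡ-≤-0≤ {s} 0≤s = *-monoˡ-≤-nonNeg s {{nonNegative 0≤s}}

*-monoʳ-≤-0≤ : 0ℚ ≤ s → p ≤ q → p * s ≤ q * s
*-monoʳ-≤-0≤ {s} 0≤s = *-monoʳ-≤-nonNeg s {{nonNegative 0≤s}}

0≤p*q : 0ℚ ≤ p → 0ℚ ≤ q → 0ℚ ≤ p * q
0≤p*q {p} {q} 0≤p 0≤q = subst (_≤ p * q) (*-zeroʳ p) (*-monoˡ-≤-0≤ 0≤p 0≤q)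

p≤p+q : 0ℚ ≤ q → p ≤ p + q
p≤p+q {q} {p} 0≤q = subst (_≤ p + q) (ℚ.+-identityʳ p) (+-monoʳ-≤ p 0≤q)

p≤q+p : 0ℚ ≤ q → p ≤ q + p
p≤q+p {q} {p} 0≤q = subst (p ≤_) (+-comm p q) (p≤p+q 0≤q)

p<1+p : ∀ p → p ℚ.< 1ℚ + p
p<1+p p = subst (ℚ._< 1ℚ + p) (+-identityˡ p) (+-monoˡ-< p 0<1)
  where
  0<1 : 0ℚ ℚ.< 1ℚ
  0<1 = ℚ.*<* (ℤ.+<+ (s≤s z≤n))

p≤p*q : 0ℚ ≤ p → 1ℚ ≤ q → p ≤ p * q
p≤p*q {p} {q} 0≤p 1≤q = subst (_≤ p * q) (*-identityʳ p) (*-monoˡ-≤-0≤ 0≤p 1≤q)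

p≤q*p : 0ℚ ≤ p → 1ℚ ≤ q → p ≤ q * p
p≤q*p {p} {q} 0≤p 1≤q = subst (_≤ q * p) (*-identityˡ p) (*-monoʳ-≤-0≤ 0≤p 1≤q)

^-nonNeg : ∀ n → 0ℚ ≤ p → 0ℚ ≤ p ^ n
^-nonNeg zero    0≤p = 0≤1
^-nonNeg (suc n) 0≤p = 0≤p*q 0≤p (^-nonNeg n 0≤p)

^-monoʳ-≤ : 1ℚ ≤ p → ∀ {a b} → a ℕ.≤ b → p ^ a ≤ p ^ b
^-monoʳ-≤ 1≤p {b = zero}  z≤n = ≤-refl
^-monoʳ-≤ 1≤p {b = suc b} z≤n =
  ≤-trans (^-monoʳ-≤ 1≤p {b = b} z≤n) (p≤q*p (^-nonNeg b (1≤p⇒0≤p 1≤p)) 1≤p)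
^-monoʳ-≤ 1≤p (s≤s a≤b) = *-monoˡ-≤-0≤ (1≤p⇒0≤p 1≤p) (^-monoʳ-≤ 1≤p a≤b)

path-row-≤ : Path m (r , c) (r′ , k) → r′ ℕ.≤ r
path-row-≤ []          = ℕ.≤-refl
path-row-≤ (right _ p) = path-row-≤ p
path-row-≤ (up p)      = ℕ.m≤n⇒m≤1+n (path-row-≤ p)

path-column-≤ : Path m (r , c) (r′ , k) → c ℕ.≤ k
path-column-≤ []          = ℕ.≤-refl
path-column-≤ (right _ p) = ℕ.<⇒≤ (path-column-≤ p)
path-column-≤ (up p)      = path-column-≤ p

sameRow-unique : (p q : Path m (r , c) (r , k)) → p ≡ q
sameRow-unique []          []           = refl
sameRow-unique []          (right _ q)  = ⊥-elim (ℕ.1+n≰n (path-column-≤ q))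
sameRow-unique (right _ p) []           = ⊥-elim (ℕ.1+n≰n (path-column-≤ p))
sameRow-unique (right h p) (right h′ q) = cong₂ right (ℕ.<-irrelevant h h′) (sameRow-unique p q)
sameRow-unique p           (up q)       = ⊥-elim (ℕ.1+n≰n (path-row-≤ q))
sameRow-unique (up p)      q            = ⊥-elim (ℕ.1+n≰n (path-row-≤ p))

sameRow⇒Horizontal : (p : Path m (r , c) (r , k)) → Horizontal p
sameRow⇒Horizontal []          = []
sameRow⇒Horizontal (right h p) = right h (sameRow⇒Horizontal p)
sameRow⇒Horizontal (up p)      = ⊥-elim (ℕ.1+n≰n (path-row-≤ p))

sameRow-path : c ℕ.≤ k → k < m → Path m (r , c) (r , k)
sameRow-path {c} {k} {m} {r} c≤k k<m = go (ℕ.≤⇒≤‴ c≤k)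
  where
  go : ∀ {c} → c ≤‴ k → Path m (r , c) (r , k)
  go ≤‴-refl         = []
  go (≤‴-step c<‴k) = right (ℕ.≤-<-trans (ℕ.≤‴⇒≤ c<‴k) k<m) (go c<‴k)

sameRow-weight : ∀ α (p : Path m (r , c) (r , k)) → weight α m p + fromℕ c ≡ fromℕ k
sameRow-weight α []          = +-identityˡ _
sameRow-weight {m} {c = c} α (right _ p) = begin
  (1ℚ + w) + fromℕ c   ≡⟨ cong (_+ fromℕ c) (+-comm 1ℚ w) ⟩
  (w + 1ℚ) + fromℕ c   ≡⟨ +-assoc w 1ℚ (fromℕ c) ⟩
  w + (1ℚ + fromℕ c)   ≡⟨ cong (_+_ w) (sym (fromℕ-suc c)) ⟩
  w + fromℕ (suc c)    ≡⟨ sameRow-weight α p ⟩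
  _                    ∎
  where
  open ≡-Reasoning
  w = weight α m p
sameRow-weight α (up p)      = ⊥-elim (ℕ.1+n≰n (path-row-≤ p))

weight-nonNeg : ∀ {α} → 0ℚ ≤ α * fromℕ m → (p : Path m u v) → 0ℚ ≤ weight α m p
weight-nonNeg 0≤a []                = ≤-refl
weight-nonNeg 0≤a (right _ p)       = ≤-trans (weight-nonNeg 0≤a p) (p≤q+p 0≤1)
weight-nonNeg 0≤a (up {c = c} p)    =
  ≤-trans (weight-nonNeg 0≤a p) (p≤q+p (^-nonNeg (2 ℕ.* c) 0≤a))

rising-weight-≥ : ∀ {α} → 1ℚ ≤ α * fromℕ m → r′ < r → (p : Path m (r , c) (r′ , k)) →
                  (α * fromℕ m) ^ (2 ℕ.* c) ≤ weight α m p
rising-weight-≥ 1≤a r′<r [] = ⊥-elim (ℕ.<-irrefl refl r′<r)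
rising-weight-≥ {c = c} 1≤a r′<r (right _ p) = ≤-trans
  (^-monoʳ-≤ 1≤a (ℕ.*-monoʳ-≤ 2 (ℕ.n≤1+n c)))
  (≤-trans (rising-weight-≥ 1≤a r′<r p) (p≤q+p 0≤1))
rising-weight-≥ 1≤a r′<r (up p) = p≤p+q (weight-nonNeg (1≤p⇒0≤p 1≤a) p)

later-climb-dominates : ∀ {α M X h} → 1ℚ ≤ α → 1ℚ + 1ℚ ≤ M → 1ℚ ≤ X → h ≤ M →
                        α * (X + h) ≤ (α * M) * ((α * M) * X)
later-climb-dominates {α} {M} {X} {h} 1≤α 2≤M 1≤X h≤M = begin
  α * (X + h)           ≤⟨ *-monoˡ-≤-0≤ 0≤α (+-mono-≤ X≤aX h≤aX) ⟩
  α * (aX + aX)         ≡⟨ cong (α *_) (sym 2*aX≡aX+aX) ⟩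
  α * ((1ℚ + 1ℚ) * aX)  ≤⟨ *-monoˡ-≤-0≤ 0≤α (*-monoʳ-≤-0≤ (0≤p*q 0≤a 0≤X) 2≤M) ⟩
  α * (M * aX)          ≡⟨ sym (*-assoc α M aX) ⟩
  (α * M) * aX          ∎
  where
  open ≤-Reasoning
  a aX : ℚ
  a  = α * M
  aX = a * X
  0≤α : 0ℚ ≤ α
  0≤α = 1≤p⇒0≤p 1≤α
  0≤X : 0ℚ ≤ X
  0≤X = 1≤p⇒0≤p 1≤X
  1≤M : 1ℚ ≤ M
  1≤M = ≤-trans (p≤p+q 0≤1) 2≤M
  M≤a : M ≤ a
  M≤a = p≤q*p (1≤p⇒0≤p 1≤M) 1≤α
  1≤a : 1ℚ ≤ a
  1≤a = ≤-trans 1≤M M≤a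
  0≤a : 0ℚ ≤ a
  0≤a = 1≤p⇒0≤p 1≤a
  X≤aX : X ≤ aX
  X≤aX = p≤q*p 0≤X 1≤a
  h≤aX : h ≤ aX
  h≤aX = ≤-trans h≤M (≤-trans M≤a (p≤p*q 0≤a 1≤X))
  2*aX≡aX+aX : (1ℚ + 1ℚ) * aX ≡ aX + aX
  2*aX≡aX+aX = trans (*-distribʳ-+ aX 1ℚ 1ℚ) (cong₂ _+_ (*-identityˡ aX) (*-identityˡ aX))

lemma5p1 : (αG : ℚ) → 1ℚ Data.Rational.< αG →
    (m i j k : ℕ) → suc i < m → j < k → k < m →
    Σ (Path m (suc i , j) (i , k)) λ P →
      UpThenHorizontal P × IsShortest αG m P ×
      ((Q : Path m (suc i , j) (i , k)) → IsApproxShortest αG αG m Q → Q ≡ P)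
lemma5p1 α 1<α m i j k 1+i<m j<k k<m = up H , up (sameRow⇒Horizontal H) , shortest , unique
  where
  H : Path m (i , j) (i , k)
  H = sameRow-path (ℕ.<⇒≤ j<k) k<m
  1≤α : 1ℚ ≤ α
  1≤α = <⇒≤ 1<α
  2≤M : 1ℚ + 1ℚ ≤ fromℕ m
  2≤M = fromℕ-mono-≤ {2} (ℕ.≤-<-trans (s≤s z≤n) 1+i<m)
  1≤a : 1ℚ ≤ α * fromℕ m
  1≤a = ≤-trans (≤-trans (p≤p+q 0≤1) 2≤M) (p≤q*p (fromℕ-mono-≤ (z≤n {m})) 1≤α)
  walk≤M : weight α m H ≤ fromℕ m
  walk≤M = ≤-trans (p≤p+q (fromℕ-mono-≤ (z≤n {j})))
                   (≤-trans (≤-reflexive (sameRow-weight α H)) (fromℕ-mono-≤ {k} {m} (ℕ.<⇒≤ k<m)))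
  detour-heavier : (Q : Path m (suc i , suc j) (i , k)) → α * weight α m (up H) ≤ weight α m Q
  detour-heavier Q = ≤-trans
    (later-climb-dominates 1≤α 2≤M (^-monoʳ-≤ 1≤a (z≤n {2 ℕ.* j})) walk≤M)
    (subst (_≤ weight α m Q) (cong ((α * fromℕ m) ^_) (ℕ.*-suc 2 j)) (rising-weight-≥ 1≤a ℕ.≤-refl Q))
  shortest : IsShortest α m (up H)
  shortest (up Q)      = ≤-reflexive (cong (λ R → weight α m (up R)) (sameRow-unique H Q))
  shortest (right _ Q) = ≤-trans (p≤q*p (weight-nonNeg (1≤p⇒0≤p 1≤a) (up H)) 1≤α)
                                 (≤-trans (detour-heavier Q) (p≤q+p 0≤1))
  unique : (Q : Path m (suc i , j) (i , k)) → IsApproxShortest α α m Q → Q ≡ up H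
  unique (up Q)      _      = cong up (sameRow-unique Q H)
  unique (right _ Q) approx =
    ⊥-elim (<-irrefl refl (<-≤-trans (p<1+p _) (≤-trans (approx (up H)) (detour-heavier Q))))
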